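{- Let $N\ge 2$ and let $A_1,A_2,\ldots$ be a quasifibonacci sequence of level $N$. Then for every positive integer $k$, $A_{k+2}>A_k+A_{k-1}+\cdots+A_1$.
   Context: For an integer $N\ge 2$, a sequence $A_1,A_2,\ldots$ of positive integers is a quasifibonacci sequence of level $N$ if $A_{k+N}=A_{k+N-1}+\cdots+A_k$ for all $k\ge 1$, and $A_k>A_{k-1}+\cdots+A_1$ for all $1\le k\le N$. -}

module Defs where

open import Data.Nat using (ℕ; zero; suc; _+_; _∸_; _≤_; _<_)
open import Relation.Binary.PropositionalEquality using (_≡_)

-- Sequences A₁, A₂, … are modelled as functions A : ℕ → ℕ, using indices ≥ 1;
-- the value A 0 is irrelevant and never constrained.

prefixSum : (ℕ → ℕ) → ℕ → ℕ
prefixSum A zero    = 0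
prefixSum A (suc k) = prefixSum A k + A (suc k)

window : (ℕ → ℕ) → ℕ → ℕ → ℕ
window A k zero    = 0
window A k (suc n) = A k + window A (suc k) n

record Quasifibonacci (N : ℕ) (A : ℕ → ℕ) : Set where
  field
    positive   : ∀ k → 1 ≤ k → 0 < A k
    recurrence : ∀ k → 1 ≤ k → A (k + N) ≡ window A k N
    initial    : ∀ k → 1 ≤ k → k ≤ N → prefixSum A (k ∸ 1) < A k

module Submission where

-- Write N = n + 2 and prove  Σ_{i ≤ t} A_i < A_{t+2}  for every
-- t ≥ 0 by induction on t (the case t = 0 is harmless and starts the induction).
--  * Initial region (t ≤ n, so t + 2 ≤ N): the defining condition of a
--    quasifibonacci sequence gives Σ_{i ≤ t+1} A_i < A_{t+2}, and dropping the
--    term A_{t+1} only makes the left side smaller.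
--  * Recurrence region (t = n + j + 1): the recurrence writes
--    A_{t+2} = A_{j+1} + ⋯ + A_{j+N}, while Σ_{i ≤ t} A_i = Σ_{i ≤ j} A_i +
--    (A_{j+1} + ⋯ + A_{j+N-1}).  The common window cancels, leaving
--    Σ_{i ≤ j} A_i < A_{j+N}, which follows from the induction hypothesis at
--    t - 1 = n + j (whose right-hand side is A_{j+N}) by monotonicity.

open import Defs
open import Data.Nat using (ℕ; zero; suc; _+_; _∸_; _≤_; _<_; _≤′_; ≤′-refl; ≤′-step; _≤?_; z≤n; s≤s)
open import Data.Nat.Properties
open import Data.Product using (_,_)
open import Relation.Nullary using (yes; no)
open import Relation.Binary.PropositionalEquality

prefixSum-mono : ∀ (A : ℕ → ℕ) {m n} → m ≤ n → prefixSum A m ≤ prefixSum A n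
prefixSum-mono A m≤n = go (≤⇒≤′ m≤n)
  where
    go : ∀ {m n} → m ≤′ n → prefixSum A m ≤ prefixSum A n
    go ≤′-refl          = ≤-refl
    go (≤′-step m≤′n)   = ≤-trans (go m≤′n) (m≤m+n _ _)

prefixSum-split : ∀ (A : ℕ → ℕ) j n →
                  prefixSum A (j + n) ≡ prefixSum A j + window A (suc j) n
prefixSum-split A j zero = begin
    prefixSum A (j + 0)  ≡⟨ cong (prefixSum A) (+-identityʳ j) ⟩
    prefixSum A j        ≡⟨ +-identityʳ (prefixSum A j) ⟨
    prefixSum A j + 0    ∎
  where open ≡-Reasoning
prefixSum-split A j (suc n) = begin
    prefixSum A (j + suc n)                                ≡⟨ cong (prefixSum A) (+-suc j n) ⟩
    prefixSum A (suc j + n)                                ≡⟨ prefixSum-split A (suc j) n ⟩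
    prefixSum A j + A (suc j) + window A (suc (suc j)) n   ≡⟨ +-assoc (prefixSum A j) _ _ ⟩
    prefixSum A j + (A (suc j) + window A (suc (suc j)) n) ∎
  where open ≡-Reasoning

window-snoc : ∀ (A : ℕ → ℕ) k n → window A k (suc n) ≡ window A k n + A (k + n)
window-snoc A k zero = begin
    A k + 0      ≡⟨ +-identityʳ (A k) ⟩
    A k          ≡⟨ cong A (+-identityʳ k) ⟨
    A (k + 0)    ∎
  where open ≡-Reasoning
window-snoc A k (suc n) = begin
    A k + window A (suc k) (suc n)             ≡⟨ cong (A k +_) (window-snoc A (suc k) n) ⟩
    A k + (window A (suc k) n + A (suc k + n)) ≡⟨ +-assoc (A k) _ _ ⟨
    A k + window A (suc k) n + A (suc k + n)   ≡⟨ cong (λ i → A k + window A (suc k) n + A i) (+-suc k n) ⟨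
    A k + window A (suc k) n + A (k + suc n)   ∎
  where open ≡-Reasoning

module _ (n : ℕ) (A : ℕ → ℕ) (Q : Quasifibonacci (suc (suc n)) A) where
  open Quasifibonacci Q

  -- Initial region: for t + 2 ≤ N the bound is a weakening of the initial
  -- condition at index t + 2.
  initial-bound : ∀ t → t ≤ n → prefixSum A t < A (t + 2)
  initial-bound t t≤n = ≤-<-trans drop-last (initial (t + 2) 1≤t+2 t+2≤N)
    where
      1≤t+2 : 1 ≤ t + 2
      1≤t+2 = subst (1 ≤_) (+-comm 2 t) (s≤s z≤n)
      t+2≤N : t + 2 ≤ suc (suc n)
      t+2≤N = subst (_≤ suc (suc n)) (+-comm 2 t) (s≤s (s≤s t≤n))
      drop-last : prefixSum A t ≤ prefixSum A (t + 2 ∸ 1)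
      drop-last = prefixSum-mono A (subst (t ≤_) (cong (_∸ 1) (+-comm 2 t)) (n≤1+n t))

  -- Recurrence region, index-free form: one unfolding of the recurrence at
  -- position j + 1 cancels the window A_{j+1} + ⋯ + A_{j+N-1} on both sides.
  recurrence-bound : ∀ j → prefixSum A j < A (suc j + suc n) →
                     prefixSum A (j + suc n) < A (suc j + suc (suc n))
  recurrence-bound j short = subst₂ _<_ (sym left) (sym right) cancelled
    where
      W : ℕ
      W = window A (suc j) (suc n)
      left : prefixSum A (j + suc n) ≡ W + prefixSum A j
      left = trans (prefixSum-split A j (suc n)) (+-comm (prefixSum A j) W)
      right : A (suc j + suc (suc n)) ≡ W + A (suc j + suc n)
      right = trans (recurrence (suc j) (s≤s z≤n)) (window-snoc A (suc j) (suc n))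
      cancelled : W + prefixSum A j < W + A (suc j + suc n)
      cancelled = +-monoʳ-< W short

  -- Inductive step: beyond the initial region t = n + j, and the hypothesis at
  -- t, weakened to the prefix of length j, is exactly what recurrence-bound needs.
  bound-step : ∀ t → prefixSum A t < A (t + 2) → prefixSum A (suc t) < A (suc t + 2)
  bound-step t ih with suc t ≤? n
  ... | yes st≤n = initial-bound (suc t) st≤n
  ... | no st≰n with m≤n⇒∃[o]m+o≡n (≤-pred (≰⇒> st≰n))
  ...   | j , refl = subst₂ _<_ (cong (prefixSum A) length≡) (cong A index≡)
                       (recurrence-bound j short)
    where
      length≡ : j + suc n ≡ suc (n + j)
      length≡ = trans (+-suc j n) (cong suc (+-comm j n))
      index≡ : suc j + suc (suc n) ≡ suc (n + j) + 2
      index≡ = cong suc (trans (+-suc j (suc n)) (trans (cong suc length≡) (+-comm 2 (n + j))))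
      ih-index≡ : n + j + 2 ≡ suc j + suc n
      ih-index≡ = trans (+-comm (n + j) 2) (cong suc (sym length≡))
      short : prefixSum A j < A (suc j + suc n)
      short = ≤-<-trans (prefixSum-mono A (m≤n+m j n))
                (subst (prefixSum A (n + j) <_) (cong A ih-index≡) ih)

  bound : ∀ t → prefixSum A t < A (t + 2)
  bound zero    = initial-bound zero z≤n
  bound (suc t) = bound-step t (bound t)

lemma2p1 : (N : ℕ) → 2 ≤ N → (A : ℕ → ℕ) → Quasifibonacci N A →
           ∀ k → 1 ≤ k → prefixSum A k < A (k + 2)
lemma2p1 (suc (suc n)) (s≤s (s≤s _)) A Q k _ = bound n A Q k
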